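{- Let $G$ be a connected, locally finite graph with vertex set $X$, equipped with the graph metric $d$, and let $z\in X$. Suppose the set of neighbors of $z$ can be partitioned into pairs such that the two vertices in each pair are non-adjacent. If $f\colon X\to\mathbb{R}$ is convex at $z$, then $f$ is subharmonic at $z$.
   Context: The graph metric $d(x,y)$ is the length of a shortest path between $x$ and $y$. A point $z$ is in between $x$ and $y$ if $d(x,y)=d(x,z)+d(z,y)$. A function $f\colon X\to\mathbb{R}$ is convex at $z$ if $f(z)\le\frac{d(y,z)}{d(x,y)}f(x)+\frac{d(x,z)}{d(x,y)}f(y)$ for all distinct $x,y\in X$ with $z$ in between $x$ and $y$. $f$ is subharmonic at $z$ if $f(z)\le\frac{1}{\deg(z)}\sum_{y\sim z}f(y)$. -}

module Defs where

open import Level using (Level; _⊔_) renaming (suc to lsuc)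
open import Algebra.Bundles using (CommutativeRing)
open import Relation.Binary.Structures using (IsTotalOrder)
open import Relation.Nullary using (¬_)
open import Relation.Binary.PropositionalEquality using (_≡_; _≢_)
open import Data.Nat using (ℕ; zero; suc; _<_) renaming (_+_ to _+ℕ_)
open import Data.Product using (Σ; ∃; _×_; _,_)
open import Data.List using (List; []; _∷_; map; foldr; length; concatMap)
open import Data.List.Membership.Propositional using (_∈_; _∉_)
open import Data.List.Relation.Unary.Unique.Propositional using (Unique)
open import Data.List.Relation.Unary.All using (All)
open import Data.List.Relation.Binary.Permutation.Propositional using (_↭_)

-- An ordered field (stand-in for ℝ; ℝ is an instance).
record OrderedField (c ℓ₁ ℓ₂ : Level) : Set (lsuc (c ⊔ ℓ₁ ⊔ ℓ₂)) where
  field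
    commutativeRing : CommutativeRing c ℓ₁
  open CommutativeRing commutativeRing public
  field
    _≤_          : Carrier → Carrier → Set ℓ₂
    isTotalOrder : IsTotalOrder _≈_ _≤_
    +-monoˡ-≤    : ∀ {x y} z → x ≤ y → (x + z) ≤ (y + z)
    *-nonneg     : ∀ {x y} → 0# ≤ x → 0# ≤ y → 0# ≤ (x * y)
    0≉1          : ¬ (0# ≈ 1#)
    inverse      : ∀ x → ¬ (x ≈ 0#) → Σ Carrier (λ y → (x * y) ≈ 1#)

  ι : ℕ → Carrier
  ι zero    = 0#
  ι (suc n) = 1# + ι n

  Σ-list : List Carrier → Carrier
  Σ-list = foldr _+_ 0#

record LocallyFiniteGraph (v : Level) : Set (lsuc v) where
  field
    Vertex       : Set v
    nbrs         : Vertex → List Vertex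
    nbrs-unique  : ∀ x → Unique (nbrs x)
    adj-sym      : ∀ {x y} → y ∈ nbrs x → x ∈ nbrs y
    adj-irrefl   : ∀ {x} → x ∉ nbrs x

  _∼_ : Vertex → Vertex → Set v
  x ∼ y = y ∈ nbrs x

  deg : Vertex → ℕ
  deg x = length (nbrs x)

  data Walk : Vertex → Vertex → ℕ → Set v where
    here : ∀ {x} → Walk x x 0
    step : ∀ {x y w n} → x ∼ y → Walk y w n → Walk x w (suc n)

  Connected : Set v
  Connected = ∀ x y → ∃ λ n → Walk x y n

  -- graph metric, as a relation: d(x,y) = n
  Dist : Vertex → Vertex → ℕ → Set v
  Dist x y n = Walk x y n × (∀ m → m < n → ¬ Walk x y m)

  NonAdjacentPairing : Vertex → Set v
  NonAdjacentPairing z =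
    Σ (List (Vertex × Vertex)) λ ps →
      (concatMap (λ { (a , b) → a ∷ b ∷ [] }) ps ↭ nbrs z)
      × All (λ { (a , b) → ¬ (a ∼ b) }) ps

module _ {v c ℓ₁ ℓ₂} (G : LocallyFiniteGraph v) (F : OrderedField c ℓ₁ ℓ₂) where
  open LocallyFiniteGraph G
  open OrderedField F

  -- convexity at z, multiplied through by d(x,y) > 0
  ConvexAt : (Vertex → Carrier) → Vertex → Set (v ⊔ ℓ₂)
  ConvexAt f z = ∀ x y → x ≢ y → ∀ n a b →
    Dist x y n → Dist x z a → Dist z y b → n ≡ a +ℕ b →
    (ι n * f z) ≤ ((ι b * f x) + (ι a * f y))

  -- subharmonicity at z, multiplied through by deg(z)
  SubharmonicAt : (Vertex → Carrier) → Vertex → Set ℓ₂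
  SubharmonicAt f z = (ι (deg z) * f z) ≤ Σ-list (map f (nbrs z))

-- Let z be such a vertex and {a, b} one of the pairs.  Since a and b are
-- distinct, non-adjacent and both adjacent to z, we have d(a,z) = d(z,b) = 1
-- and d(a,b) = 2, so z lies between a and b and convexity at z gives
-- 2·f(z) ≤ f(a) + f(b).  Summing these inequalities over all pairs yields
-- deg(z)·f(z) ≤ Σ_{y ∼ z} f(y), which is subharmonicity (multiplied by deg z).
module Submission where

open import Defs
open import Relation.Nullary using (¬_)
open import Relation.Binary.Bundles using (Poset)
open import Relation.Binary.PropositionalEquality as ≡ using (_≡_; _≢_; cong; subst)
open import Data.Nat using (zero; suc; s≤s) renaming (_+_ to _+ℕ_)
open import Data.Product using (_×_; _,_)
open import Data.List using (List; []; _∷_; map; length; concatMap)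
open import Data.List.Membership.Propositional using (_∈_)
open import Data.List.Relation.Unary.Any using (here; there)
open import Data.List.Relation.Unary.All as All using (All; []; _∷_)
open import Data.List.Relation.Unary.AllPairs using (_∷_)
open import Data.List.Relation.Unary.Unique.Propositional using (Unique)
open import Data.List.Relation.Binary.Permutation.Propositional using (_↭_; ↭-sym; ↭⇒↭ₛ)
open import Data.List.Relation.Binary.Permutation.Propositional.Properties using (↭-length; ∈-resp-↭; map⁺)
import Data.List.Relation.Binary.Permutation.Homogeneous as Permutation
import Data.List.Relation.Binary.Permutation.Setoid.Properties as SetoidPermutation
import Relation.Binary.Reasoning.PartialOrder as ≤-Reasoning
open import Relation.Binary.Structures using (IsTotalOrder)

flatten : ∀ {ℓ} {A : Set ℓ} → List (A × A) → List A
flatten = concatMap (λ { (a , b) → a ∷ b ∷ [] })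

module _ {ℓ} {A : Set ℓ} where

  flatten-distinct : (ps : List (A × A)) → Unique (flatten ps) →
                     All (λ { (a , b) → a ≢ b }) ps
  flatten-distinct []             _                        = []
  flatten-distinct ((a , b) ∷ ps) ((a≢b ∷ _) ∷ _ ∷ unique) = a≢b ∷ flatten-distinct ps unique

  flatten-members : ∀ {p} {P : A → Set p} (ps : List (A × A)) →
                    (∀ {x} → x ∈ flatten ps → P x) → All (λ { (a , b) → P a × P b }) ps
  flatten-members []             _   = []
  flatten-members ((a , b) ∷ ps) holds =
    (holds (here ≡.refl) , holds (there (here ≡.refl))) ∷ flatten-members ps (λ x∈ → holds (there (there x∈)))

module OrderedFieldFacts {c ℓ₁ ℓ₂} (F : OrderedField c ℓ₁ ℓ₂) where
  open OrderedField F

  poset : Poset c ℓ₁ ℓ₂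
  poset = record { isPartialOrder = IsTotalOrder.isPartialOrder isTotalOrder }

  open Poset poset public using (≤-respʳ-≈) renaming (reflexive to ≤-reflexive)
  open ≤-Reasoning poset

  +-mono-≤ : ∀ {x x′ y y′} → x ≤ x′ → y ≤ y′ → (x + y) ≤ (x′ + y′)
  +-mono-≤ {x} {x′} {y} {y′} x≤x′ y≤y′ = begin
    x + y    ≤⟨ +-monoˡ-≤ y x≤x′ ⟩
    x′ + y   ≈⟨ +-comm x′ y ⟩
    y + x′   ≤⟨ +-monoˡ-≤ x′ y≤y′ ⟩
    y′ + x′  ≈⟨ +-comm y′ x′ ⟩
    x′ + y′  ∎

  ι-+ : ∀ m n → ι (m +ℕ n) ≈ (ι m + ι n)
  ι-+ zero    n = sym (+-identityˡ (ι n))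
  ι-+ (suc m) n = trans (+-congˡ (ι-+ m n)) (sym (+-assoc 1# (ι m) (ι n)))

  ι-1* : ∀ x → (ι 1 * x) ≈ x
  ι-1* x = trans (*-congʳ (+-identityʳ 1#)) (*-identityˡ x)

  Σ-map-↭ : ∀ {ℓ} {A : Set ℓ} (g : A → Carrier) {xs ys : List A} →
            xs ↭ ys → Σ-list (map g xs) ≈ Σ-list (map g ys)
  Σ-map-↭ g xs↭ys =
    SetoidPermutation.foldr-commMonoid setoid +-isCommutativeMonoid
      (Permutation.map reflexive (↭⇒↭ₛ (map⁺ g xs↭ys)))

  pair-sum-bound : ∀ {ℓ} {A : Set ℓ} (g : A → Carrier) (x : Carrier) (ps : List (A × A)) →
                   All (λ { (a , b) → (ι 2 * x) ≤ (g a + g b) }) ps →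
                   (ι (length (flatten ps)) * x) ≤ Σ-list (map g (flatten ps))
  pair-sum-bound g x []             []             = ≤-reflexive (zeroˡ x)
  pair-sum-bound g x ((a , b) ∷ ps) (pair ∷ pairs) = begin
    ι (2 +ℕ n) * x               ≈⟨ *-congʳ (ι-+ 2 n) ⟩
    (ι 2 + ι n) * x              ≈⟨ distribʳ x (ι 2) (ι n) ⟩
    ι 2 * x + ι n * x            ≤⟨ +-mono-≤ pair (pair-sum-bound g x ps pairs) ⟩
    (g a + g b) + rest           ≈⟨ +-assoc (g a) (g b) rest ⟩
    g a + (g b + rest)           ∎
    where
    n    = length (flatten ps)
    rest = Σ-list (map g (flatten ps))

module GraphFacts {v} (G : LocallyFiniteGraph v) where
  open LocallyFiniteGraph G

  walk-0 : ∀ {x y} → Walk x y 0 → x ≡ y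
  walk-0 here = ≡.refl

  walk-1 : ∀ {x y} → Walk x y 1 → x ∼ y
  walk-1 (step x∼y here) = x∼y

  adjacent-dist : ∀ {x y} → x ∼ y → Dist x y 1
  adjacent-dist {x} x∼y = step x∼y here , λ
    { zero    _          w → adj-irrefl (subst (λ t → t ∈ nbrs x) (≡.sym (walk-0 w)) x∼y)
    ; (suc m) (s≤s ()) }

  common-neighbour-dist : ∀ {x y z} → x ≢ y → ¬ (x ∼ y) → x ∼ z → z ∼ y → Dist x y 2
  common-neighbour-dist x≢y x≁y x∼z z∼y = step x∼z (step z∼y here) , λ
    { zero          _                w → x≢y (walk-0 w)
    ; (suc zero)    _                w → x≁y (walk-1 w)
    ; (suc (suc m)) (s≤s (s≤s ())) }

  NonAdjacentNeighbours : Vertex → Vertex × Vertex → Set v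
  NonAdjacentNeighbours z (a , b) = (z ∼ a × z ∼ b) × (a ≢ b × ¬ (a ∼ b))

  pairing-pairs : ∀ z ps → flatten ps ↭ nbrs z → All (λ { (a , b) → ¬ (a ∼ b) }) ps →
                  All (NonAdjacentNeighbours z) ps
  pairing-pairs z ps perm nonadjacent =
    All.zip (flatten-members ps (∈-resp-↭ perm) , All.zip (flatten-distinct ps unique , nonadjacent))
    where
    unique : Unique (flatten ps)
    unique = SetoidPermutation.Unique-resp-↭ (≡.setoid Vertex) (↭⇒↭ₛ (↭-sym perm)) (nbrs-unique z)

module ConvexityFacts {v c ℓ₁ ℓ₂} (G : LocallyFiniteGraph v) (F : OrderedField c ℓ₁ ℓ₂) where
  open LocallyFiniteGraph G
  open OrderedField F
  open OrderedFieldFacts F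
  open GraphFacts G

  convex-pair : ∀ {f z} → ConvexAt G F f z → ∀ {a b} → NonAdjacentNeighbours z (a , b) →
                (ι 2 * f z) ≤ (f a + f b)
  convex-pair {f} {z} convex {a} {b} ((z∼a , z∼b) , (a≢b , a≁b)) =
    ≤-respʳ-≈ (+-cong (ι-1* (f a)) (ι-1* (f b)))
      (convex a b a≢b 2 1 1 (common-neighbour-dist a≢b a≁b (adj-sym z∼a) z∼b)
                            (adjacent-dist (adj-sym z∼a)) (adjacent-dist z∼b) ≡.refl)

mainTheorem6 : ∀ {v c ℓ₁ ℓ₂} (G : LocallyFiniteGraph v) (F : OrderedField c ℓ₁ ℓ₂) →
    LocallyFiniteGraph.Connected G →
    (z : LocallyFiniteGraph.Vertex G) →
    LocallyFiniteGraph.NonAdjacentPairing G z →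
    (f : LocallyFiniteGraph.Vertex G → OrderedField.Carrier F) →
    ConvexAt G F f z → SubharmonicAt G F f z
mainTheorem6 G F _ z (ps , perm , nonadjacent) f convex = begin
  ι (deg z) * f z                     ≡⟨ cong (λ n → ι n * f z) (↭-length perm) ⟨
  ι (length (flatten ps)) * f z       ≤⟨ pair-sum-bound f (f z) ps pair-bounds ⟩
  Σ-list (map f (flatten ps))         ≈⟨ Σ-map-↭ f perm ⟩
  Σ-list (map f (nbrs z))             ∎
  where
  open LocallyFiniteGraph G
  open OrderedField F
  open OrderedFieldFacts F
  open GraphFacts G
  open ConvexityFacts G F
  open ≤-Reasoning poset

  pair-bounds : All (λ { (a , b) → (ι 2 * f z) ≤ (f a + f b) }) ps
  pair-bounds = All.map (convex-pair convex) (pairing-pairs z ps perm nonadjacent)
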